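{- If $G$ is a finite cubic graph on $n$ vertices that has a DET:OLD set, then $\mathrm{DET{:}OLD}(G)\le n-1$.
   Context: For a graph $G$ and $v\in V(G)$, $N(v)$ is the open neighborhood of $v$. For $S\subseteq V(G)$ write $N_S(v)=N(v)\cap S$. A set $S\subseteq V(G)$ is a DET:OLD set of $G$ if (1) every vertex $v$ satisfies $|N_S(v)|\ge 2$, and (2) every pair of distinct vertices $u,v$ satisfies $|N_S(u)\setminus N_S(v)|\ge 2$ or $|N_S(v)\setminus N_S(u)|\ge 2$. $\mathrm{DET{:}OLD}(G)$ is the minimum cardinality of a DET:OLD set of $G$. A cubic graph is a 3-regular simple graph. -}

module Defs where

open import Data.Nat using (ℕ; _≤_; _∸_)
open import Data.Bool using (Bool; true; false)
open import Data.Fin using (Fin)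
open import Data.Fin.Subset using (Subset; _∩_; _─_; ∣_∣)
open import Data.Vec using (tabulate)
open import Data.Product using (_×_; Σ; ∃)
open import Data.Sum using (_⊎_)
open import Relation.Binary.PropositionalEquality using (_≡_; _≢_)

record Graph (n : ℕ) : Set where
  field
    Adj   : Fin n → Fin n → Bool
    sym   : ∀ u v → Adj u v ≡ Adj v u
    irrefl : ∀ v → Adj v v ≡ false

open Graph public

N : ∀ {n} → Graph n → Fin n → Subset n
N G v = tabulate (Adj G v)

N[_]_ : ∀ {n} → Graph n → Subset n → Fin n → Subset n
(N[ G ] S) v = N G v ∩ S

Cubic : ∀ {n} → Graph n → Set
Cubic {n} G = ∀ (v : Fin n) → ∣ N G v ∣ ≡ 3

IsDetOLD : ∀ {n} → Graph n → Subset n → Set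
IsDetOLD {n} G S =
  (∀ (v : Fin n) → 2 ≤ ∣ (N[ G ] S) v ∣)
  × (∀ (u v : Fin n) → u ≢ v →
       (2 ≤ ∣ (N[ G ] S) u ─ (N[ G ] S) v ∣) ⊎ (2 ≤ ∣ (N[ G ] S) v ─ (N[ G ] S) u ∣))

HasDetOLD : ∀ {n} → Graph n → Set
HasDetOLD {n} G = ∃ λ (S : Subset n) → IsDetOLD G S

-- DET:OLD(G) ≤ k  iff some DET:OLD set has cardinality ≤ k
-- (the minimum cardinality is ≤ k exactly when such a set exists)
DetOLD≤ : ∀ {n} → Graph n → ℕ → Set
DetOLD≤ {n} G k = ∃ λ (S : Subset n) → IsDetOLD G S × ∣ S ∣ ≤ k

{-# OPTIONS --safe #-}
-- Both DET:OLD conditions are monotone in S, so if some DET:OLD set exists then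
-- distinct vertices u, v satisfy |N(u) ∖ N(v)| ≥ 2 or |N(v) ∖ N(u)| ≥ 2.  In a
-- cubic graph these two differences have the same size, so both are at least 2.
-- They are disjoint, so any vertex x lies outside one of them, and that
-- difference survives intact in V ∖ {x}; degrees drop from 3 to at least 2.
-- Hence V ∖ {x} is a DET:OLD set of size n − 1.
module Submission where

open import Defs hiding (sym)
open import Data.Nat using (ℕ; zero; suc; _+_; _∸_; _≤_)
open import Data.Nat.Properties
  using (module ≤-Reasoning; ≤-trans; ≤-reflexive; +-monoʳ-≤; +-cancelʳ-≡; +-cancelʳ-≤; +-suc)
open import Data.Bool using (true; false)
open import Data.Vec using ([]; _∷_; here; there)
open import Data.Fin using (Fin; zero; suc)
open import Data.Fin.Subset using (Subset; _∩_; _─_; _-_; ∁; ⁅_⁆; ∣_∣; _∈_; _∉_)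
open import Data.Fin.Subset.Properties
  using (_∈?_; ∩-comm; p─⊥≡p; p─q⊆p; ∣p∣≤n; ∣p∩q∣≤∣p∣; ∣p∩q∣≤∣q∣; ∣∁p∣≡n∸∣p∣; ∣⁅x⁆∣≡1)
open import Data.Product using (_,_)
open import Data.Sum using (_⊎_; inj₁; inj₂)
open import Relation.Nullary using (yes; no; contradiction)
open import Relation.Binary.PropositionalEquality
  using (_≡_; _≢_; refl; sym; trans; cong; cong₂; subst; module ≡-Reasoning)

∣p─q∣+∣p∩q∣≡∣p∣ : ∀ {n} (p q : Subset n) → ∣ p ─ q ∣ + ∣ p ∩ q ∣ ≡ ∣ p ∣
∣p─q∣+∣p∩q∣≡∣p∣ []          []          = refl
∣p─q∣+∣p∩q∣≡∣p∣ (true  ∷ p) (true  ∷ q) =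
  trans (+-suc ∣ p ─ q ∣ ∣ p ∩ q ∣) (cong suc (∣p─q∣+∣p∩q∣≡∣p∣ p q))
∣p─q∣+∣p∩q∣≡∣p∣ (true  ∷ p) (false ∷ q) = cong suc (∣p─q∣+∣p∩q∣≡∣p∣ p q)
∣p─q∣+∣p∩q∣≡∣p∣ (false ∷ p) (true  ∷ q) = ∣p─q∣+∣p∩q∣≡∣p∣ p q
∣p─q∣+∣p∩q∣≡∣p∣ (false ∷ p) (false ∷ q) = ∣p─q∣+∣p∩q∣≡∣p∣ p q

∣p∣≤∣p─q∣+∣q∣ : ∀ {n} (p q : Subset n) → ∣ p ∣ ≤ ∣ p ─ q ∣ + ∣ q ∣
∣p∣≤∣p─q∣+∣q∣ p q = subst (_≤ ∣ p ─ q ∣ + ∣ q ∣) (∣p─q∣+∣p∩q∣≡∣p∣ p q)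
  (+-monoʳ-≤ ∣ p ─ q ∣ (∣p∩q∣≤∣q∣ p q))

∣p∣≡∣q∣⇒∣p─q∣≡∣q─p∣ : ∀ {n} (p q : Subset n) → ∣ p ∣ ≡ ∣ q ∣ → ∣ p ─ q ∣ ≡ ∣ q ─ p ∣
∣p∣≡∣q∣⇒∣p─q∣≡∣q─p∣ p q ∣p∣≡∣q∣ = +-cancelʳ-≡ ∣ p ∩ q ∣ _ _ (begin
  ∣ p ─ q ∣ + ∣ p ∩ q ∣ ≡⟨ ∣p─q∣+∣p∩q∣≡∣p∣ p q ⟩
  ∣ p ∣                 ≡⟨ ∣p∣≡∣q∣ ⟩
  ∣ q ∣                 ≡⟨ ∣p─q∣+∣p∩q∣≡∣p∣ q p ⟨
  ∣ q ─ p ∣ + ∣ q ∩ p ∣ ≡⟨ cong (λ r → ∣ q ─ p ∣ + ∣ r ∣) (∩-comm q p) ⟩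
  ∣ q ─ p ∣ + ∣ p ∩ q ∣ ∎)
  where open ≡-Reasoning

p∩r─q∩r≡[p─q]∩r : ∀ {n} (p q r : Subset n) → p ∩ r ─ q ∩ r ≡ (p ─ q) ∩ r
p∩r─q∩r≡[p─q]∩r []          []          []          = refl
p∩r─q∩r≡[p─q]∩r (true  ∷ p) (true  ∷ q) (true  ∷ r) = cong (_ ∷_) (p∩r─q∩r≡[p─q]∩r p q r)
p∩r─q∩r≡[p─q]∩r (true  ∷ p) (true  ∷ q) (false ∷ r) = cong (_ ∷_) (p∩r─q∩r≡[p─q]∩r p q r)
p∩r─q∩r≡[p─q]∩r (true  ∷ p) (false ∷ q) (true  ∷ r) = cong (_ ∷_) (p∩r─q∩r≡[p─q]∩r p q r)
p∩r─q∩r≡[p─q]∩r (true  ∷ p) (false ∷ q) (false ∷ r) = cong (_ ∷_) (p∩r─q∩r≡[p─q]∩r p q r)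
p∩r─q∩r≡[p─q]∩r (false ∷ p) (true  ∷ q) (true  ∷ r) = cong (_ ∷_) (p∩r─q∩r≡[p─q]∩r p q r)
p∩r─q∩r≡[p─q]∩r (false ∷ p) (true  ∷ q) (false ∷ r) = cong (_ ∷_) (p∩r─q∩r≡[p─q]∩r p q r)
p∩r─q∩r≡[p─q]∩r (false ∷ p) (false ∷ q) (true  ∷ r) = cong (_ ∷_) (p∩r─q∩r≡[p─q]∩r p q r)
p∩r─q∩r≡[p─q]∩r (false ∷ p) (false ∷ q) (false ∷ r) = cong (_ ∷_) (p∩r─q∩r≡[p─q]∩r p q r)

p∩∁q≡p─q : ∀ {n} (p q : Subset n) → p ∩ ∁ q ≡ p ─ q
p∩∁q≡p─q []          []          = refl
p∩∁q≡p─q (true  ∷ p) (true  ∷ q) = cong (_ ∷_) (p∩∁q≡p─q p q)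
p∩∁q≡p─q (true  ∷ p) (false ∷ q) = cong (_ ∷_) (p∩∁q≡p─q p q)
p∩∁q≡p─q (false ∷ p) (true  ∷ q) = cong (_ ∷_) (p∩∁q≡p─q p q)
p∩∁q≡p─q (false ∷ p) (false ∷ q) = cong (_ ∷_) (p∩∁q≡p─q p q)

x∈p─q⇒x∉q : ∀ {n} {x : Fin n} (p q : Subset n) → x ∈ p ─ q → x ∉ q
x∈p─q⇒x∉q             (_ ∷ p) (false ∷ q) here       ()
x∈p─q⇒x∉q {x = zero} (_ ∷ p) (true  ∷ q) ()
x∈p─q⇒x∉q             (_ ∷ p) (_     ∷ q) (there x∈) (there x∈q) = x∈p─q⇒x∉q p q x∈ x∈q

x∉p⇒p-x≡p : ∀ {n} {x : Fin n} (p : Subset n) → x ∉ p → p - x ≡ p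
x∉p⇒p-x≡p {x = zero}  (true  ∷ p) x∉p = contradiction here x∉p
x∉p⇒p-x≡p {x = zero}  (false ∷ p) x∉p = cong (false ∷_) (p─⊥≡p p)
x∉p⇒p-x≡p {x = suc x} (a     ∷ p) x∉p = cong (a ∷_) (x∉p⇒p-x≡p p (λ x∈p → x∉p (there x∈p)))

∣∁⁅x⁆∣≡n∸1 : ∀ {n} (x : Fin n) → ∣ ∁ ⁅ x ⁆ ∣ ≡ n ∸ 1
∣∁⁅x⁆∣≡n∸1 {n} x = trans (∣∁p∣≡n∸∣p∣ ⁅ x ⁆) (cong (n ∸_) (∣⁅x⁆∣≡1 x))

∣p∣≤∣p∩∁⁅x⁆∣+1 : ∀ {n} (p : Subset n) (x : Fin n) → ∣ p ∣ ≤ ∣ p ∩ ∁ ⁅ x ⁆ ∣ + 1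
∣p∣≤∣p∩∁⁅x⁆∣+1 p x = begin
  ∣ p ∣                   ≤⟨ ∣p∣≤∣p─q∣+∣q∣ p ⁅ x ⁆ ⟩
  ∣ p - x ∣ + ∣ ⁅ x ⁆ ∣   ≡⟨ cong₂ _+_ (cong ∣_∣ (sym (p∩∁q≡p─q p ⁅ x ⁆))) (∣⁅x⁆∣≡1 x) ⟩
  ∣ p ∩ ∁ ⁅ x ⁆ ∣ + 1     ∎
  where open ≤-Reasoning

x∉p─q⊎x∉q─p : ∀ {n} (p q : Subset n) (x : Fin n) → x ∉ p ─ q ⊎ x ∉ q ─ p
x∉p─q⊎x∉q─p p q x with x ∈? q
... | yes x∈q = inj₁ λ x∈p─q → x∈p─q⇒x∉q p q x∈p─q x∈q
... | no  x∉q = inj₂ λ x∈q─p → x∉q (p─q⊆p q p x∈q─p)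

x∉p─q⇒p∩∁⁅x⁆─q∩∁⁅x⁆≡p─q : ∀ {n} (p q : Subset n) {x : Fin n} → x ∉ p ─ q →
                           p ∩ ∁ ⁅ x ⁆ ─ q ∩ ∁ ⁅ x ⁆ ≡ p ─ q
x∉p─q⇒p∩∁⁅x⁆─q∩∁⁅x⁆≡p─q p q {x} x∉p─q = begin
  p ∩ ∁ ⁅ x ⁆ ─ q ∩ ∁ ⁅ x ⁆ ≡⟨ p∩r─q∩r≡[p─q]∩r p q (∁ ⁅ x ⁆) ⟩
  (p ─ q) ∩ ∁ ⁅ x ⁆         ≡⟨ p∩∁q≡p─q (p ─ q) ⁅ x ⁆ ⟩
  p ─ q - x                 ≡⟨ x∉p⇒p-x≡p (p ─ q) x∉p─q ⟩
  p ─ q                     ∎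
  where open ≡-Reasoning

∩∁⁅x⁆-preserves-difference : ∀ {n k} (p q : Subset n) (x : Fin n) →
  k ≤ ∣ p ─ q ∣ → k ≤ ∣ q ─ p ∣ →
  k ≤ ∣ p ∩ ∁ ⁅ x ⁆ ─ q ∩ ∁ ⁅ x ⁆ ∣ ⊎ k ≤ ∣ q ∩ ∁ ⁅ x ⁆ ─ p ∩ ∁ ⁅ x ⁆ ∣
∩∁⁅x⁆-preserves-difference p q x k≤∣p─q∣ k≤∣q─p∣ with x∉p─q⊎x∉q─p p q x
... | inj₁ x∉p─q =
  inj₁ (subst (λ r → _ ≤ ∣ r ∣) (sym (x∉p─q⇒p∩∁⁅x⁆─q∩∁⁅x⁆≡p─q p q x∉p─q)) k≤∣p─q∣)
... | inj₂ x∉q─p =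
  inj₂ (subst (λ r → _ ≤ ∣ r ∣) (sym (x∉p─q⇒p∩∁⁅x⁆─q∩∁⁅x⁆≡p─q q p x∉q─p)) k≤∣q─p∣)

module _ {n : ℕ} (G : Graph n) where

  ∣N[S]u─N[S]v∣≤∣Nu─Nv∣ : ∀ S u v → ∣ (N[ G ] S) u ─ (N[ G ] S) v ∣ ≤ ∣ N G u ─ N G v ∣
  ∣N[S]u─N[S]v∣≤∣Nu─Nv∣ S u v =
    subst (_≤ ∣ N G u ─ N G v ∣) (cong ∣_∣ (sym (p∩r─q∩r≡[p─q]∩r (N G u) (N G v) S)))
          (∣p∩q∣≤∣p∣ (N G u ─ N G v) S)

  HasDetOLD⇒N-separating : HasDetOLD G → ∀ u v → u ≢ v →
                           2 ≤ ∣ N G u ─ N G v ∣ ⊎ 2 ≤ ∣ N G v ─ N G u ∣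
  HasDetOLD⇒N-separating (S , _ , separating) u v u≢v with separating u v u≢v
  ... | inj₁ 2≤ = inj₁ (≤-trans 2≤ (∣N[S]u─N[S]v∣≤∣Nu─Nv∣ S u v))
  ... | inj₂ 2≤ = inj₂ (≤-trans 2≤ (∣N[S]u─N[S]v∣≤∣Nu─Nv∣ S v u))

  Cubic⇒∣Nu─Nv∣≡∣Nv─Nu∣ : Cubic G → ∀ u v → ∣ N G u ─ N G v ∣ ≡ ∣ N G v ─ N G u ∣
  Cubic⇒∣Nu─Nv∣≡∣Nv─Nu∣ cubic u v =
    ∣p∣≡∣q∣⇒∣p─q∣≡∣q─p∣ (N G u) (N G v) (trans (cubic u) (sym (cubic v)))

  IsDetOLD-∁⁅x⁆ : Cubic G → HasDetOLD G → ∀ x → IsDetOLD G (∁ ⁅ x ⁆)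
  IsDetOLD-∁⁅x⁆ cubic hasDetOLD x = dominating , separating
    where
    dominating : ∀ v → 2 ≤ ∣ (N[ G ] ∁ ⁅ x ⁆) v ∣
    dominating v = +-cancelʳ-≤ 1 2 _
      (subst (_≤ ∣ (N[ G ] ∁ ⁅ x ⁆) v ∣ + 1) (cubic v) (∣p∣≤∣p∩∁⁅x⁆∣+1 (N G v) x))

    separating : ∀ u v → u ≢ v → 2 ≤ ∣ (N[ G ] ∁ ⁅ x ⁆) u ─ (N[ G ] ∁ ⁅ x ⁆) v ∣
                                 ⊎ 2 ≤ ∣ (N[ G ] ∁ ⁅ x ⁆) v ─ (N[ G ] ∁ ⁅ x ⁆) u ∣
    separating u v u≢v with HasDetOLD⇒N-separating hasDetOLD u v u≢v
    ... | inj₁ 2≤ = ∩∁⁅x⁆-preserves-difference (N G u) (N G v) x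
                      2≤ (subst (2 ≤_) (Cubic⇒∣Nu─Nv∣≡∣Nv─Nu∣ cubic u v) 2≤)
    ... | inj₂ 2≤ = ∩∁⁅x⁆-preserves-difference (N G u) (N G v) x
                      (subst (2 ≤_) (Cubic⇒∣Nu─Nv∣≡∣Nv─Nu∣ cubic v u) 2≤) 2≤

corollary13 : ∀ (n : ℕ) (G : Graph n) → Cubic G → HasDetOLD G → DetOLD≤ G (n ∸ 1)
corollary13 zero    G cubic (S , S-DetOLD) = S , S-DetOLD , ∣p∣≤n S
corollary13 (suc m) G cubic hasDetOLD =
  ∁ ⁅ zero ⁆ , IsDetOLD-∁⁅x⁆ G cubic hasDetOLD zero , ≤-reflexive (∣∁⁅x⁆∣≡n∸1 zero)
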